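{- For integers $m,k$ with $1\le 2k-1\le 2m-1$, $$\tilde L_{2m-1,2k-1}=\tilde L_{2m-1,2k-2}+\sum_{i=2k-2}^{2m-3}\tilde L_{2m-3,i},\qquad \tilde L_{2m-1,2k}=\tilde L_{2m-1,2k-1}-\sum_{i=1}^{2k-2}\tilde L_{2m-3,i}.$$
   Context: For $m\ge1$, let $\tilde L_{2m-1}=[\ell_{i,j}]_{1\le i,j\le 2m-1}$ be the 0/1 matrix with $\ell_{i,j}=1$ if ($1\le i\le m-1$ and $2i\le j\le 2m-1$), or ($m\le i\le 2m-2$ and $1\le j\le 2(i-m)+2$), or $i=2m-1$; and $\ell_{i,j}=0$ otherwise. For $1\le i\le 2m-1$, $\tilde L_{2m-1,i}$ denotes the permanent of the submatrix of $\tilde L_{2m-1}$ obtained by deleting row $2m-1$ and column $i$, where $\mathrm{per}[a_{i,j}]_{1\le i,j\le N}=\sum_{\pi\in\mathfrak S_N}\prod_i a_{i,\pi(i)}$. By convention $\tilde L_{2m-1,0}=\tilde L_{2m-1,2m}=0$ for all $m\ge1$, and empty sums are $0$. -}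

module Defs where

open import Data.Bool using (Bool; true; false; _∧_; _∨_; if_then_else_)
open import Data.Nat as ℕ using (ℕ; zero; suc; _∸_; _<ᵇ_; _≤ᵇ_; _≡ᵇ_)
open import Data.Fin as Fin using (Fin; toℕ)
open import Data.Fin.Properties using (_≟_)
open import Data.Integer as ℤ using (ℤ; +_)
open import Data.List as List using (List; []; _∷_; map; concatMap; filter; allFin)
open import Data.Vec as Vec using (Vec; lookup; toList)
import Data.List.Relation.Unary.Unique.DecPropositional as UD

sumℤ : List ℤ → ℤ
sumℤ = List.foldr ℤ._+_ (+ 0)

prodℤ : List ℤ → ℤ
prodℤ = List.foldr ℤ._*_ (+ 1)

allVecs : (N n : ℕ) → List (Vec (Fin N) n)
allVecs N zero    = Vec.[] ∷ []
allVecs N (suc n) = concatMap (λ v → map (λ x → x Vec.∷ v) (allFin N)) (allVecs N n)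

perms : (N : ℕ) → List (Vec (Fin N) N)
perms N = filter (λ π → UD.unique? (_≟_ {n = N}) (toList π)) (allVecs N N)

per : (N : ℕ) → (Fin N → Fin N → ℤ) → ℤ
per N A = sumℤ (map (λ π → prodℤ (map (λ i → A i (lookup π i)) (allFin N))) (perms N))

b2z : Bool → ℤ
b2z true  = + 1
b2z false = + 0

-- Entry ℓ_{i,j} of L̃_{2m-1} (1-based indices i, j).
ell : (m i j : ℕ) → ℤ
ell m i j = b2z
  (  ((1 ≤ᵇ i) ∧ (i ≤ᵇ m ∸ 1) ∧ (2 ℕ.* i ≤ᵇ j) ∧ (j ≤ᵇ 2 ℕ.* m ∸ 1))
   ∨ ((m ≤ᵇ i) ∧ (i ≤ᵇ 2 ℕ.* m ∸ 2) ∧ (1 ≤ᵇ j) ∧ (j ≤ᵇ 2 ℕ.* (i ∸ m) ℕ.+ 2))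
   ∨ (i ≡ᵇ 2 ℕ.* m ∸ 1))

-- Lt m c = L̃_{2m-1,c}: permanent of L̃_{2m-1} with row 2m-1 and column c deleted
-- (for 1 ≤ c ≤ 2m-1); 0 otherwise (covers the conventions c = 0 and c = 2m).
Lt : (m c : ℕ) → ℤ
Lt m c =
  if (1 ≤ᵇ c) ∧ (c ≤ᵇ 2 ℕ.* m ∸ 1)
  then per (2 ℕ.* m ∸ 2)
         (λ r s → ell m (suc (toℕ r))
                        (if suc (toℕ s) <ᵇ c then suc (toℕ s) else suc (suc (toℕ s))))
  else + 0

-- Σ_{i=a}^{b} f i  (empty, i.e. 0, when b < a).
sumFromTo : ℕ → ℕ → (ℕ → ℤ) → ℤ
sumFromTo a b f = sumℤ (map (λ t → f (a ℕ.+ t)) (List.upTo (suc b ∸ a)))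

-- Columns 2k−2 and 2k−1 of L̃_{2m−1} differ only in the lower row m+k−2, and columns 2k−1 and 2k
-- only in the upper row k. As the permanent is affine in each entry, L̃_{2m−1,c} − L̃_{2m−1,c−1}
-- (c = 2k−1, resp. c = 2k) is ±1 times the permanent of the minor without the last row, that row
-- and both columns. In this minor the upper row k−1 (resp. the lower row m+k−1) is the indicator
-- of the columns i ≥ 2k−2 (resp. i ≤ 2k−2), and the remaining rows are those of L̃_{2m−3} without
-- its last row: every other threshold 2i (resp. 2(i−m)+2) lies outside the deleted pair of columns
-- and drops by two exactly when its row index drops by one. Expanding along the indicator row gives
-- the sums of the L̃_{2m−3,i}. For c = 1 and c = 2m, where the neighbouring term vanishes, the
-- lower row m (resp. the upper row m−1) has a single nonzero entry once column c (resp. c − 1) is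
-- deleted, and the same expansion applies.

module Submission where

open import Defs
open import Algebra.Bundles using (CommutativeMonoid)
import Algebra.Properties.CommutativeMonoid.Sum as CommutativeMonoidSum
open import Data.Bool using (Bool; true; false; not; _∧_; _∨_; if_then_else_)
import Data.Bool.Properties as BoolP
open import Data.Empty using (⊥-elim)
open import Data.Fin as Fin using (Fin; toℕ; fromℕ<; punchIn)
open import Data.Fin.Properties using (_≟_; punchInᵢ≢i; punchIn-injective; toℕ<n; toℕ-fromℕ<)
open import Data.Integer as ℤ using (ℤ; +_; _+_; _*_; _-_)
import Data.Integer.Properties as ℤP
open import Data.Integer.Tactic.RingSolver using (solve-∀)
open import Data.List as List using (List; []; _∷_; map; concatMap; filter; allFin; _++_)
import Data.List.Properties as ListP
import Data.List.Relation.Unary.All as All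
import Data.List.Relation.Unary.Unique.DecPropositional as Unique
open import Data.Nat as ℕ using (ℕ; zero; suc; _∸_; _≤_; _<_; _<ᵇ_; _≤ᵇ_; _≡ᵇ_; _<?_; _≤?_; z≤n; s≤s)
import Data.Nat.Properties as ℕP
open import Data.Product using (_×_; _,_)
open import Data.Sum using (inj₁; inj₂)
open import Data.Vec as Vec using (Vec; []; _∷_; lookup; toList; insertAt)
import Data.Vec.Properties as VecP
open import Function using (_∘_)
open import Relation.Binary.Definitions using (tri<; tri≈; tri>)
open import Relation.Binary.PropositionalEquality
open import Relation.Nullary using (Dec; does; yes; no; ¬?)
open import Relation.Nullary.Decidable using (dec-true; dec-false)

open import Algebra.Properties.CommutativeSemigroup
  (CommutativeMonoid.commutativeSemigroup BoolP.∧-commutativeMonoid) using (interchange; x∙yz≈y∙xz)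
open CommutativeMonoidSum ℤP.+-0-commutativeMonoid
  using (sum; sum-syntax; sum-remove; ∑-comm; sum-cong-≗; sum-replicate-zero)
open import Algebra.Properties.Semiring.Sum ℤP.+-*-semiring using (*-distribˡ-sum)
module Product = CommutativeMonoidSum ℤP.*-1-commutativeMonoid

∏ : ∀ {n} → (Fin n → ℤ) → ℤ
∏ = Product.sum

sumMap : ∀ {A : Set} → List A → (A → ℤ) → ℤ
sumMap xs f = sumℤ (map f xs)

sumMap-++ : ∀ {A : Set} (xs ys : List A) (f : A → ℤ) →
  sumMap (xs ++ ys) f ≡ sumMap xs f + sumMap ys f
sumMap-++ []       ys f = sym (ℤP.+-identityˡ _)
sumMap-++ (x ∷ xs) ys f = trans (cong (_+_ (f x)) (sumMap-++ xs ys f)) (sym (ℤP.+-assoc (f x) _ _))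

sumMap-concatMap : ∀ {A B : Set} (xs : List A) (h : A → List B) (f : B → ℤ) →
  sumMap (concatMap h xs) f ≡ sumMap xs (λ x → sumMap (h x) f)
sumMap-concatMap []       h f = refl
sumMap-concatMap (x ∷ xs) h f =
  trans (sumMap-++ (h x) (concatMap h xs) f) (cong (_+_ (sumMap (h x) f)) (sumMap-concatMap xs h f))

sumMap-filter : ∀ {A : Set} {P : A → Set} (P? : ∀ x → Dec (P x)) xs (f : A → ℤ) →
  sumMap (filter P? xs) f ≡ sumMap xs (λ x → if does (P? x) then f x else + 0)
sumMap-filter P? []       f = refl
sumMap-filter P? (x ∷ xs) f with does (P? x)
... | true  = cong (_+_ (f x)) (sumMap-filter P? xs f)
... | false = trans (sumMap-filter P? xs f) (sym (ℤP.+-identityˡ _))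

sumℤ-tabulate : ∀ {n} (f : Fin n → ℤ) → sumℤ (List.tabulate f) ≡ sum f
sumℤ-tabulate {zero}  f = refl
sumℤ-tabulate {suc n} f = cong (_+_ (f Fin.zero)) (sumℤ-tabulate (f ∘ Fin.suc))

prodℤ-tabulate : ∀ {n} (f : Fin n → ℤ) → prodℤ (List.tabulate f) ≡ ∏ f
prodℤ-tabulate {zero}  f = refl
prodℤ-tabulate {suc n} f = cong (_*_ (f Fin.zero)) (prodℤ-tabulate (f ∘ Fin.suc))

sumMap-allFin : ∀ N (f : Fin N → ℤ) → sumMap (allFin N) f ≡ ∑[ x < N ] f x
sumMap-allFin N f = trans (cong sumℤ (ListP.map-tabulate (λ x → x) f)) (sumℤ-tabulate f)

sum-if : ∀ {N} (b : Bool) (F : Fin N → ℤ) →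
  ∑[ y < N ] (if b then F y else + 0) ≡ (if b then ∑[ y < N ] F y else + 0)
sum-if     true  F = refl
sum-if {N} false F = sum-replicate-zero N

∑ᵛ : ∀ N n → (Vec (Fin N) n → ℤ) → ℤ
∑ᵛ N zero    g = g []
∑ᵛ N (suc n) g = ∑ᵛ N n (λ w → ∑[ x < N ] g (x ∷ w))

sumMap-allVecs : ∀ N n (g : Vec (Fin N) n → ℤ) → sumMap (allVecs N n) g ≡ ∑ᵛ N n g
sumMap-allVecs N zero    g = ℤP.+-identityʳ (g [])
sumMap-allVecs N (suc n) g = begin
  sumMap (allVecs N (suc n)) g
    ≡⟨ sumMap-concatMap (allVecs N n) _ g ⟩
  sumMap (allVecs N n) (λ w → sumMap (map (_∷ w) (allFin N)) g)
    ≡⟨ cong sumℤ (ListP.map-cong (λ w → cong sumℤ (sym (ListP.map-∘ (allFin N)))) (allVecs N n)) ⟩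
  sumMap (allVecs N n) (λ w → sumMap (allFin N) (λ x → g (x ∷ w)))
    ≡⟨ cong sumℤ (ListP.map-cong (λ w → sumMap-allFin N _) (allVecs N n)) ⟩
  sumMap (allVecs N n) (λ w → ∑[ x < N ] g (x ∷ w))
    ≡⟨ sumMap-allVecs N n _ ⟩
  ∑ᵛ N (suc n) g ∎
  where open ≡-Reasoning

∑ᵛ-cong : ∀ N n {f g : Vec (Fin N) n → ℤ} → (∀ v → f v ≡ g v) → ∑ᵛ N n f ≡ ∑ᵛ N n g
∑ᵛ-cong N zero    eq = eq []
∑ᵛ-cong N (suc n) eq = ∑ᵛ-cong N n (λ w → sum-cong-≗ (λ x → eq (x ∷ w)))

∑ᵛ-comm : ∀ N n M (h : Vec (Fin N) n → Fin M → ℤ) →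
  ∑ᵛ N n (λ w → ∑[ x < M ] h w x) ≡ ∑[ x < M ] ∑ᵛ N n (λ w → h w x)
∑ᵛ-comm N zero    M h = refl
∑ᵛ-comm N (suc n) M h =
  trans (∑ᵛ-cong N n (λ w → ∑-comm (λ y x → h (y ∷ w) x))) (∑ᵛ-comm N n M _)

∑ᵛ-distribˡ : ∀ N n c (f : Vec (Fin N) n → ℤ) → ∑ᵛ N n (λ v → c * f v) ≡ c * ∑ᵛ N n f
∑ᵛ-distribˡ N zero    c f = refl
∑ᵛ-distribˡ N (suc n) c f =
  trans (∑ᵛ-cong N n (λ w → sym (*-distribˡ-sum c (λ x → f (x ∷ w))))) (∑ᵛ-distribˡ N n c _)

∑ᵛ-insertAt : ∀ N n (r : Fin (suc n)) (g : Vec (Fin N) (suc n) → ℤ) →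
  ∑ᵛ N (suc n) g ≡ ∑[ x < N ] ∑ᵛ N n (λ w → g (insertAt w r x))
∑ᵛ-insertAt N n       Fin.zero    g = ∑ᵛ-comm N n N (λ w x → g (x ∷ w))
∑ᵛ-insertAt N (suc n) (Fin.suc r) g = ∑ᵛ-insertAt N n r (λ w → ∑[ y < N ] g (y ∷ w))

-- Row expansion of the permanent

_≢ᵇ_ : ∀ {N} → Fin N → Fin N → Bool
x ≢ᵇ y = not (does (x ≟ y))

avoids : ∀ {N n} → Fin N → Vec (Fin N) n → Bool
avoids x []      = true
avoids x (y ∷ v) = x ≢ᵇ y ∧ avoids x v

distinct : ∀ {N n} → Vec (Fin N) n → Bool
distinct []      = true
distinct (y ∷ v) = avoids y v ∧ distinct v

unique?-distinct : ∀ {N n} (v : Vec (Fin N) n) → does (Unique.unique? _≟_ (toList v)) ≡ distinct v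
unique?-distinct     []      = refl
unique?-distinct {N} (y ∷ v) = cong₂ _∧_ (all?-avoids v) (unique?-distinct v)
  where
  all?-avoids : ∀ {n} (w : Vec (Fin N) n) → does (All.all? (λ z → ¬? (y ≟ z)) (toList w)) ≡ avoids y w
  all?-avoids []      = refl
  all?-avoids (z ∷ w) = cong (_∧_ (y ≢ᵇ z)) (all?-avoids w)

≢ᵇ-sym : ∀ {N} (x y : Fin N) → x ≢ᵇ y ≡ y ≢ᵇ x
≢ᵇ-sym x y with x ≟ y | y ≟ x
... | yes _   | yes _   = refl
... | no  _   | no  _   = refl
... | yes x≡y | no  y≢x = ⊥-elim (y≢x (sym x≡y))
... | no  x≢y | yes y≡x = ⊥-elim (x≢y (sym y≡x))

≢ᵇ-refl : ∀ {N} (x : Fin N) → x ≢ᵇ x ≡ false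
≢ᵇ-refl x = cong not (dec-true (x ≟ x) refl)

≢ᵇ-punchIn : ∀ {N} (x : Fin (suc N)) i → x ≢ᵇ punchIn x i ≡ true
≢ᵇ-punchIn x i = cong not (dec-false (x ≟ punchIn x i) (punchInᵢ≢i x i ∘ sym))

punchIn-≢ᵇ : ∀ {N} (x : Fin (suc N)) i j → punchIn x i ≢ᵇ punchIn x j ≡ i ≢ᵇ j
punchIn-≢ᵇ x i j with punchIn x i ≟ punchIn x j | i ≟ j
... | yes _  | yes _   = refl
... | no  _  | no  _   = refl
... | yes eq | no  i≢j = ⊥-elim (i≢j (punchIn-injective x i j eq))
... | no  ne | yes i≡j = ⊥-elim (ne (cong (punchIn x) i≡j))

avoids-insertAt : ∀ {N n} (y : Fin N) (w : Vec (Fin N) n) r x →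
  avoids y (insertAt w r x) ≡ y ≢ᵇ x ∧ avoids y w
avoids-insertAt y w       Fin.zero    x = refl
avoids-insertAt y (z ∷ w) (Fin.suc r) x =
  trans (cong (_∧_ (y ≢ᵇ z)) (avoids-insertAt y w r x)) (x∙yz≈y∙xz (y ≢ᵇ z) (y ≢ᵇ x) (avoids y w))

distinct-insertAt : ∀ {N n} (w : Vec (Fin N) n) r x →
  distinct (insertAt w r x) ≡ avoids x w ∧ distinct w
distinct-insertAt w       Fin.zero    x = refl
distinct-insertAt (y ∷ w) (Fin.suc r) x =
  trans (cong₂ _∧_ (trans (avoids-insertAt y w r x) (cong (_∧ avoids y w) (≢ᵇ-sym y x)))
                   (distinct-insertAt w r x))
        (interchange (x ≢ᵇ y) (avoids y w) (avoids x w) (distinct w))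

avoids-map-punchIn : ∀ {N n} (x : Fin (suc N)) (y : Fin N) (w : Vec (Fin N) n) →
  avoids (punchIn x y) (Vec.map (punchIn x) w) ≡ avoids y w
avoids-map-punchIn x y []      = refl
avoids-map-punchIn x y (z ∷ w) = cong₂ _∧_ (punchIn-≢ᵇ x y z) (avoids-map-punchIn x y w)

distinct-map-punchIn : ∀ {N n} (x : Fin (suc N)) (w : Vec (Fin N) n) →
  distinct (Vec.map (punchIn x) w) ≡ distinct w
distinct-map-punchIn x []      = refl
distinct-map-punchIn x (y ∷ w) = cong₂ _∧_ (avoids-map-punchIn x y w) (distinct-map-punchIn x w)

sum-≢ᵇ : ∀ {N} (x : Fin (suc N)) (G : Fin (suc N) → ℤ) →
  ∑[ y < suc N ] (if x ≢ᵇ y then G y else + 0) ≡ ∑[ i < N ] G (punchIn x i)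
sum-≢ᵇ x G = begin
  ∑[ y < suc _ ] (if x ≢ᵇ y then G y else + 0)
    ≡⟨ sum-remove {i = x} (λ y → if x ≢ᵇ y then G y else + 0) ⟩
  (if x ≢ᵇ x then G x else + 0) + ∑[ i < _ ] (if x ≢ᵇ punchIn x i then G (punchIn x i) else + 0)
    ≡⟨ cong₂ _+_ (cong (if_then G x else + 0) (≢ᵇ-refl x))
                 (sum-cong-≗ (λ i → cong (if_then G (punchIn x i) else + 0) (≢ᵇ-punchIn x i))) ⟩
  + 0 + ∑[ i < _ ] G (punchIn x i)
    ≡⟨ ℤP.+-identityˡ _ ⟩
  ∑[ i < _ ] G (punchIn x i) ∎
  where open ≡-Reasoning

∑ᵛ-avoiding : ∀ N n (x : Fin (suc N)) (g : Vec (Fin (suc N)) n → ℤ) →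
  ∑ᵛ (suc N) n (λ v → if avoids x v then g v else + 0) ≡ ∑ᵛ N n (λ w → g (Vec.map (punchIn x) w))
∑ᵛ-avoiding N zero    x g = refl
∑ᵛ-avoiding N (suc n) x g =
  trans (∑ᵛ-cong (suc N) n {g = λ w → if avoids x w then h w else + 0} (λ w →
           trans (sum-cong-≗ (λ y → if-∧ {g (y ∷ w)} (x ≢ᵇ y) (avoids x w))) (sum-if (avoids x w) (G w))))
  (trans (∑ᵛ-avoiding N n x h)
         (∑ᵛ-cong N n (λ w → sum-≢ᵇ x (λ y → g (y ∷ Vec.map (punchIn x) w)))))
  where
  G : Vec (Fin (suc N)) n → Fin (suc N) → ℤ
  G w y = if x ≢ᵇ y then g (y ∷ w) else + 0
  h : Vec (Fin (suc N)) n → ℤ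
  h w = ∑[ y < suc N ] G w y
  if-∧ : ∀ {u} a b → (if a ∧ b then u else + 0) ≡ (if b then (if a then u else + 0) else + 0)
  if-∧ true  b     = refl
  if-∧ false true  = refl
  if-∧ false false = refl

injTerm : ∀ {n N} → (Fin n → Fin N → ℤ) → Vec (Fin N) n → ℤ
injTerm A v = if distinct v then ∏ (λ i → A i (lookup v i)) else + 0

injPer : ∀ n N → (Fin n → Fin N → ℤ) → ℤ
injPer n N A = ∑ᵛ N n (injTerm A)

per≡injPer : ∀ N (A : Fin N → Fin N → ℤ) → per N A ≡ injPer N N A
per≡injPer N A =
  trans (sumMap-filter _ (allVecs N N) _)
  (trans (cong sumℤ (ListP.map-cong term≡ (allVecs N N)))
         (sumMap-allVecs N N (injTerm A)))
  where
  term≡ : ∀ v → (if does (Unique.unique? _≟_ (toList v))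
                   then prodℤ (map (λ i → A i (lookup v i)) (allFin N)) else + 0)
              ≡ injTerm A v
  term≡ v = cong₂ (if_then_else + 0) (unique?-distinct v)
    (trans (cong prodℤ (ListP.map-tabulate (λ i → i) (λ i → A i (lookup v i))))
           (prodℤ-tabulate (λ i → A i (lookup v i))))

injPer-cong : ∀ n N {A B : Fin n → Fin N → ℤ} → (∀ i j → A i j ≡ B i j) → injPer n N A ≡ injPer n N B
injPer-cong n N eq = ∑ᵛ-cong N n (λ v →
  cong (if distinct v then_else + 0) (Product.sum-cong-≗ (λ i → eq i (lookup v i))))

per-cong : ∀ n {A B : Fin n → Fin n → ℤ} → (∀ i j → A i j ≡ B i j) → per n A ≡ per n B
per-cong n {A} {B} eq = trans (per≡injPer n A) (trans (injPer-cong n n eq) (sym (per≡injPer n B)))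

∏-insertAt : ∀ {n N} (A : Fin (suc n) → Fin N → ℤ) w r x →
  ∏ (λ i → A i (lookup (insertAt w r x) i)) ≡ A r x * ∏ (λ i → A (punchIn r i) (lookup w i))
∏-insertAt A w r x =
  trans (Product.sum-remove {i = r} (λ i → A i (lookup (insertAt w r x) i)))
        (cong₂ _*_ (cong (A r) (VecP.insertAt-lookup w r x))
                   (Product.sum-cong-≗ (λ i → cong (A (punchIn r i)) (VecP.insertAt-punchIn w r x i))))

injPer-expand : ∀ n N (A : Fin (suc n) → Fin (suc N) → ℤ) (r : Fin (suc n)) →
  injPer (suc n) (suc N) A ≡
  ∑[ x < suc N ] (A r x * injPer n N (λ a b → A (punchIn r a) (punchIn x b)))
injPer-expand n N A r =
  trans (∑ᵛ-insertAt (suc N) n r (injTerm A))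
  (sum-cong-≗ λ x →
    trans (∑ᵛ-cong (suc N) n (term-insertAt x))
    (trans (∑ᵛ-avoiding N n x (λ w → A r x * injTerm Aᵣ w))
    (trans (∑ᵛ-cong N n (λ w → cong (A r x *_) (term-map x w)))
           (∑ᵛ-distribˡ N n (A r x) _))))
  where
  Aᵣ : Fin n → Fin (suc N) → ℤ
  Aᵣ a = A (punchIn r a)
  term-insertAt : ∀ x w →
    injTerm A (insertAt w r x) ≡ (if avoids x w then A r x * injTerm Aᵣ w else + 0)
  term-insertAt x w rewrite distinct-insertAt w r x | ∏-insertAt A w r x
    with avoids x w | distinct w
  ... | true  | true  = refl
  ... | true  | false = sym (ℤP.*-zeroʳ (A r x))
  ... | false | _     = refl
  term-map : ∀ x w → injTerm Aᵣ (Vec.map (punchIn x) w) ≡ injTerm (λ a b → Aᵣ a (punchIn x b)) w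
  term-map x w = cong₂ (if_then_else + 0) (distinct-map-punchIn x w)
    (Product.sum-cong-≗ (λ i → cong (Aᵣ i) (VecP.lookup-map i (punchIn x) w)))

<ᵇ-true : ∀ {a b} → a < b → (a <ᵇ b) ≡ true
<ᵇ-true {a} {b} = dec-true (a <? b)

<ᵇ-false : ∀ {a b} → b ≤ a → (a <ᵇ b) ≡ false
<ᵇ-false {a} {b} b≤a = dec-false (a <? b) (ℕP.≤⇒≯ b≤a)

≤ᵇ-true : ∀ {a b} → a ≤ b → (a ≤ᵇ b) ≡ true
≤ᵇ-true {a} {b} = dec-true (a ≤? b)

≤ᵇ-false : ∀ {a b} → b < a → (a ≤ᵇ b) ≡ false
≤ᵇ-false {a} {b} b<a = dec-false (a ≤? b) (ℕP.<⇒≱ b<a)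

≡ᵇ-false : ∀ {a b} → a ≢ b → (a ≡ᵇ b) ≡ false
≡ᵇ-false {a} {b} = dec-false (a ℕ.≟ b)

<ᵇ≡not-≤ᵇ : ∀ a b → (a <ᵇ b) ≡ not (b ≤ᵇ a)
<ᵇ≡not-≤ᵇ a b with a <? b
... | yes a<b rewrite <ᵇ-true a<b | ≤ᵇ-false a<b = refl
... | no  a≮b rewrite <ᵇ-false (ℕP.≮⇒≥ a≮b) | ≤ᵇ-true (ℕP.≮⇒≥ a≮b) = refl

≤ᵇ-suc : ∀ {a P} → a ≢ suc P → (a ≤ᵇ P) ≡ (a ≤ᵇ suc P)
≤ᵇ-suc {a} {P} a≢1+P with a ≤? P
... | yes a≤P rewrite ≤ᵇ-true a≤P | ≤ᵇ-true (ℕP.m≤n⇒m≤1+n a≤P) = refl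
... | no  a≰P rewrite ≤ᵇ-false (ℕP.≰⇒> a≰P)
                    | ≤ᵇ-false (ℕP.≤∧≢⇒< (ℕP.≰⇒> a≰P) (a≢1+P ∘ sym)) = refl

-- Stated for the normal form of 2 ℕ.* suc n, so that it can rewrite unfolded goals.
+-suc-+0 : ∀ n → n ℕ.+ suc (n ℕ.+ 0) ≡ suc (n ℕ.+ n)
+-suc-+0 n = trans (cong (n ℕ.+_) (ℕP.+-identityʳ (suc n))) (ℕP.+-suc n n)

2*suc : ∀ n → 2 ℕ.* suc n ≡ suc (suc (n ℕ.+ n))
2*suc n = cong suc (+-suc-+0 n)

2*≡+ : ∀ a → 2 ℕ.* a ≡ a ℕ.+ a
2*≡+ a = cong (a ℕ.+_) (ℕP.+-identityʳ a)

double-< : ∀ {a b} → a < b → suc (suc (a ℕ.+ a)) ≤ b ℕ.+ b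
double-< {a} {b} a<b = subst (_≤ b ℕ.+ b) (cong suc (ℕP.+-suc a a)) (ℕP.+-mono-≤ a<b a<b)

double-≤ : ∀ {a b} → a ≤ b → a ℕ.+ a ≤ b ℕ.+ b
double-≤ a≤b = ℕP.+-mono-≤ a≤b a≤b

double≢odd : ∀ a b → a ℕ.+ a ≢ suc (b ℕ.+ b)
double≢odd a b eq = ℕP.even≢odd a b (trans (2*≡+ a) (trans eq (cong suc (sym (2*≡+ b)))))

double-injective : ∀ {a b} → a ℕ.+ a ≡ b ℕ.+ b → a ≡ b
double-injective {a} {b} eq = ℕP.*-cancelˡ-≡ a b 2 (trans (2*≡+ a) (trans eq (sym (2*≡+ b))))

punchInℕ : ℕ → ℕ → ℕ
punchInℕ p a = if a <ᵇ p then a else suc a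

toℕ-punchIn : ∀ {n} (i : Fin (suc n)) (j : Fin n) → toℕ (punchIn i j) ≡ punchInℕ (toℕ i) (toℕ j)
toℕ-punchIn Fin.zero    j           = refl
toℕ-punchIn (Fin.suc i) Fin.zero    = refl
toℕ-punchIn (Fin.suc i) (Fin.suc j) =
  trans (cong suc (toℕ-punchIn i j)) (BoolP.if-float suc (toℕ j <ᵇ toℕ i))

punchInℕ-< : ∀ {p a} → a < p → punchInℕ p a ≡ a
punchInℕ-< a<p rewrite <ᵇ-true a<p = refl

punchInℕ-≥ : ∀ {p a} → p ≤ a → punchInℕ p a ≡ suc a
punchInℕ-≥ p≤a rewrite <ᵇ-false p≤a = refl

punchInℕ-≢ : ∀ p a → punchInℕ p a ≢ p
punchInℕ-≢ p a with a <? p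
... | yes a<p = λ eq → ℕP.<-irrefl (trans (sym (punchInℕ-< a<p)) eq) a<p
... | no  a≮p = λ eq → ℕP.<-irrefl (trans (sym eq) (punchInℕ-≥ p≤a)) (ℕP.≤-<-trans p≤a (ℕP.n<1+n a))
  where p≤a = ℕP.≮⇒≥ a≮p

punchInℕ-suc : ∀ {p a} → a ≢ p → punchInℕ (suc p) a ≡ punchInℕ p a
punchInℕ-suc {p} {a} a≢p with ℕP.<-cmp a p
... | tri< a<p _ _ = trans (punchInℕ-< (ℕP.m<n⇒m<1+n a<p)) (sym (punchInℕ-< a<p))
... | tri≈ _ a≡p _ = ⊥-elim (a≢p a≡p)
... | tri> _ _ p<a = trans (punchInℕ-≥ p<a) (sym (punchInℕ-≥ (ℕP.<⇒≤ p<a)))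

punchInℕ-≤ : ∀ p a → punchInℕ p a ≤ suc a
punchInℕ-≤ p a with a <? p
... | yes a<p = ℕP.≤-trans (ℕP.≤-reflexive (punchInℕ-< a<p)) (ℕP.n≤1+n a)
... | no  a≮p = ℕP.≤-reflexive (punchInℕ-≥ (ℕP.≮⇒≥ a≮p))

punchInℕ-+ : ∀ c p a → punchInℕ (c ℕ.+ p) (c ℕ.+ a) ≡ c ℕ.+ punchInℕ p a
punchInℕ-+ zero    p a = refl
punchInℕ-+ (suc c) p a =
  trans (sym (BoolP.if-float suc ((c ℕ.+ a) <ᵇ (c ℕ.+ p)))) (cong suc (punchInℕ-+ c p a))

punchInPair : ℕ → ℕ → ℕ
punchInPair P y = punchInℕ (suc P) (punchInℕ P y)

punchInPair-< : ∀ {P y} → y < P → punchInPair P y ≡ y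
punchInPair-< y<P rewrite punchInℕ-< y<P = punchInℕ-< (ℕP.m<n⇒m<1+n y<P)

punchInPair-≥ : ∀ {P y} → P ≤ y → punchInPair P y ≡ suc (suc y)
punchInPair-≥ P≤y rewrite punchInℕ-≥ P≤y = punchInℕ-≥ (s≤s P≤y)

Σ< : ℕ → (ℕ → ℤ) → ℤ
Σ< n g = ∑[ i < n ] g (toℕ i)

Σ<-cong : ∀ n {f g : ℕ → ℤ} → (∀ x → x < n → f x ≡ g x) → Σ< n f ≡ Σ< n g
Σ<-cong n eq = sum-cong-≗ (λ i → eq (toℕ i) (toℕ<n i))

Σ<-remove : ∀ n {P} (g : ℕ → ℤ) → P < suc n → Σ< (suc n) g ≡ g P + Σ< n (λ t → g (punchInℕ P t))
Σ<-remove n g P< =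
  trans (sum-remove {i = fromℕ< P<} (λ i → g (toℕ i)))
        (cong₂ _+_ (cong g (toℕ-fromℕ< P<))
                   (sum-cong-≗ (λ i → cong g (trans (toℕ-punchIn (fromℕ< P<) i)
                                                    (cong (λ p → punchInℕ p (toℕ i)) (toℕ-fromℕ< P<))))))

Σ<-+ : ∀ a l (g : ℕ → ℤ) → Σ< (a ℕ.+ l) g ≡ Σ< a g + Σ< l (λ t → g (a ℕ.+ t))
Σ<-+ zero    l g = sym (ℤP.+-identityˡ _)
Σ<-+ (suc a) l g = trans (cong (_+_ (g 0)) (Σ<-+ a l (g ∘ suc))) (sym (ℤP.+-assoc (g 0) _ _))

Σ<-last : ∀ n (g : ℕ → ℤ) → Σ< (suc n) g ≡ Σ< n g + g n
Σ<-last zero    g = trans (ℤP.+-identityʳ (g 0)) (sym (ℤP.+-identityˡ (g 0)))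
Σ<-last (suc n) g = trans (cong (_+_ (g 0)) (Σ<-last n (g ∘ suc))) (sym (ℤP.+-assoc (g 0) _ _))

Σ<-zero : ∀ n {g : ℕ → ℤ} → (∀ x → x < n → g x ≡ + 0) → Σ< n g ≡ + 0
Σ<-zero n eq = trans (Σ<-cong n eq) (sum-replicate-zero n)

Σ<-from : ∀ {P N} (g : ℕ → ℤ) → P ≤ N →
  Σ< N (λ x → b2z (P ≤ᵇ x) * g x) ≡ Σ< (N ∸ P) (λ t → g (P ℕ.+ t))
Σ<-from {P} {N} g P≤N = begin
  Σ< N (λ x → b2z (P ≤ᵇ x) * g x)
    ≡⟨ cong (λ z → Σ< z (λ x → b2z (P ≤ᵇ x) * g x)) (sym (ℕP.m+[n∸m]≡n P≤N)) ⟩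
  Σ< (P ℕ.+ (N ∸ P)) (λ x → b2z (P ≤ᵇ x) * g x)
    ≡⟨ Σ<-+ P (N ∸ P) h ⟩
  Σ< P (λ x → b2z (P ≤ᵇ x) * g x) + Σ< (N ∸ P) (λ t → b2z (P ≤ᵇ P ℕ.+ t) * g (P ℕ.+ t))
    ≡⟨ cong₂ _+_ (Σ<-zero P (λ x x<P → cong (λ b → b2z b * g x) (≤ᵇ-false x<P)))
                 (Σ<-cong (N ∸ P) (λ t _ → trans (cong (λ b → b2z b * g (P ℕ.+ t)) (≤ᵇ-true (ℕP.m≤m+n P t)))
                                               (ℤP.*-identityˡ (g (P ℕ.+ t))))) ⟩
  + 0 + Σ< (N ∸ P) (λ t → g (P ℕ.+ t))
    ≡⟨ ℤP.+-identityˡ _ ⟩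
  Σ< (N ∸ P) (λ t → g (P ℕ.+ t)) ∎
  where
  open ≡-Reasoning
  h : ℕ → ℤ
  h x = b2z (P ≤ᵇ x) * g x

Σ<-below : ∀ {P N} (g : ℕ → ℤ) → P ≤ N → Σ< N (λ x → b2z (not (P ≤ᵇ x)) * g x) ≡ Σ< P g
Σ<-below {P} {N} g P≤N = begin
  Σ< N (λ x → b2z (not (P ≤ᵇ x)) * g x)
    ≡⟨ cong (λ z → Σ< z (λ x → b2z (not (P ≤ᵇ x)) * g x)) (sym (ℕP.m+[n∸m]≡n P≤N)) ⟩
  Σ< (P ℕ.+ (N ∸ P)) (λ x → b2z (not (P ≤ᵇ x)) * g x)
    ≡⟨ Σ<-+ P (N ∸ P) h ⟩
  Σ< P (λ x → b2z (not (P ≤ᵇ x)) * g x) + Σ< (N ∸ P) (λ t → b2z (not (P ≤ᵇ P ℕ.+ t)) * g (P ℕ.+ t))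
    ≡⟨ cong₂ _+_ (Σ<-cong P (λ x x<P → trans (cong (λ b → b2z (not b) * g x) (≤ᵇ-false x<P))
                                              (ℤP.*-identityˡ (g x))))
                 (Σ<-zero (N ∸ P) (λ t _ →
                    cong (λ b → b2z (not b) * g (P ℕ.+ t)) (≤ᵇ-true (ℕP.m≤m+n P t)))) ⟩
  Σ< P g + + 0
    ≡⟨ ℤP.+-identityʳ _ ⟩
  Σ< P g ∎
  where
  open ≡-Reasoning
  h : ℕ → ℤ
  h x = b2z (not (P ≤ᵇ x)) * g x

sumℤ-applyUpTo : ∀ n (f : ℕ → ℕ) (g : ℕ → ℤ) → sumℤ (map g (List.applyUpTo f n)) ≡ Σ< n (g ∘ f)
sumℤ-applyUpTo zero    f g = refl
sumℤ-applyUpTo (suc n) f g = cong (_+_ (g (f 0))) (sumℤ-applyUpTo n (f ∘ suc) g)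

sumFromTo-Σ< : ∀ a b f → sumFromTo a b f ≡ Σ< (suc b ∸ a) (λ t → f (a ℕ.+ t))
sumFromTo-Σ< a b f = sumℤ-applyUpTo (suc b ∸ a) (λ t → t) (λ t → f (a ℕ.+ t))

perℕ : ℕ → (ℕ → ℕ → ℤ) → ℤ
perℕ n F = per n (λ i j → F (toℕ i) (toℕ j))

minor : (ℕ → ℕ → ℤ) → ℕ → ℕ → ℕ → ℕ → ℤ
minor F R X a b = F (punchInℕ R a) (punchInℕ X b)

perℕ-cong : ∀ n {F G : ℕ → ℕ → ℤ} → (∀ a b → a < n → b < n → F a b ≡ G a b) →
  perℕ n F ≡ perℕ n G
perℕ-cong n eq = per-cong n (λ i j → eq (toℕ i) (toℕ j) (toℕ<n i) (toℕ<n j))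

perℕ-expand : ∀ n (F : ℕ → ℕ → ℤ) {R} → R < suc n →
  perℕ (suc n) F ≡ Σ< (suc n) (λ X → F R X * perℕ n (minor F R X))
perℕ-expand n F {R} R< =
  trans (per≡injPer (suc n) F′)
  (trans (injPer-expand n n F′ r)
         (sum-cong-≗ (λ x → cong₂ _*_ (cong (λ z → F z (toℕ x)) toℕr≡R)
           (trans (injPer-cong n n (λ a b → cong₂ F
                     (trans (toℕ-punchIn r a) (cong (λ p → punchInℕ p (toℕ a)) toℕr≡R))
                     (toℕ-punchIn x b)))
                  (sym (per≡injPer n (λ a b → minor F R (toℕ x) (toℕ a) (toℕ b))))))))
  where
  F′ : Fin (suc n) → Fin (suc n) → ℤ
  F′ i j = F (toℕ i) (toℕ j)
  r : Fin (suc n)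
  r = fromℕ< R<
  toℕr≡R : toℕ r ≡ R
  toℕr≡R = toℕ-fromℕ< R<

perℕ-single : ∀ n (F : ℕ → ℕ → ℤ) {R P} → R < suc n → P < suc n →
  (∀ b → b < n → F R (punchInℕ P b) ≡ + 0) → perℕ (suc n) F ≡ F R P * perℕ n (minor F R P)
perℕ-single n F {R} {P} R< P< row-zero = begin
  perℕ (suc n) F
    ≡⟨ perℕ-expand n F R< ⟩
  Σ< (suc n) (λ X → F R X * perℕ n (minor F R X))
    ≡⟨ Σ<-remove n (λ X → F R X * perℕ n (minor F R X)) P< ⟩
  F R P * perℕ n (minor F R P) + Σ< n (λ t → F R (punchInℕ P t) * perℕ n (minor F R (punchInℕ P t)))
    ≡⟨ cong (_+_ (F R P * perℕ n (minor F R P))) (Σ<-zero n (λ t t< →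
         trans (cong (_* M (punchInℕ P t)) (row-zero t t<)) (ℤP.*-zeroˡ (M (punchInℕ P t))))) ⟩
  F R P * perℕ n (minor F R P) + + 0
    ≡⟨ ℤP.+-identityʳ _ ⟩
  F R P * perℕ n (minor F R P) ∎
  where
  open ≡-Reasoning
  M : ℕ → ℤ
  M X = perℕ n (minor F R X)

perℕ-adjacent-columns : ∀ n (E : ℕ → ℕ → ℤ) {R P} → R < suc n → P < suc n →
  (∀ r → r ≢ R → E r P ≡ E r (suc P)) →
  perℕ (suc n) (λ r s → E r (punchInℕ (suc P) s)) ≡
  perℕ (suc n) (λ r s → E r (punchInℕ P s))
  + (E R P - E R (suc P)) * perℕ n (λ a b → E (punchInℕ R a) (punchInPair P b))
perℕ-adjacent-columns n E {R} {P} R< P< columns-agree = begin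
  perℕ (suc n) F
    ≡⟨ trans (perℕ-expand n F R<) (Σ<-remove n (λ X → F R X * M F X) P<) ⟩
  F R P * M F P + Σ< n (λ t → F R (punchInℕ P t) * M F (punchInℕ P t))
    ≡⟨ cong₂ (λ u z → E R u * M F P + z) (punchInℕ-< (ℕP.n<1+n P)) (Σ<-cong n same-terms) ⟩
  E R P * M F P + S
    ≡⟨ shift (E R P) (E R (suc P)) (M F P) S ⟩
  (E R (suc P) * M F P + S) + (E R P - E R (suc P)) * M F P
    ≡⟨ cong (λ z → z + (E R P - E R (suc P)) * M F P)
         (cong₂ (λ u z → E R u * z + S) (sym (punchInℕ-≥ (ℕP.≤-refl {P}))) (same-minors P)) ⟩
  (G R P * M G P + S) + (E R P - E R (suc P)) * M F P
    ≡⟨ cong (λ z → z + (E R P - E R (suc P)) * M F P)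
         (sym (trans (perℕ-expand n G R<) (Σ<-remove n (λ X → G R X * M G X) P<))) ⟩
  perℕ (suc n) G + (E R P - E R (suc P)) * M F P ∎
  where
  open ≡-Reasoning
  F G : ℕ → ℕ → ℤ
  F r s = E r (punchInℕ (suc P) s)
  G r s = E r (punchInℕ P s)
  M : (ℕ → ℕ → ℤ) → ℕ → ℤ
  M H X = perℕ n (minor H R X)
  S : ℤ
  S = Σ< n (λ t → G R (punchInℕ P t) * M G (punchInℕ P t))
  F≡G-off-R : ∀ r s → r ≢ R → F r s ≡ G r s
  F≡G-off-R r s r≢R with s ℕ.≟ P
  ... | yes refl = trans (cong (E r) (punchInℕ-< (ℕP.n<1+n P)))
                   (trans (columns-agree r r≢R) (cong (E r) (sym (punchInℕ-≥ (ℕP.≤-refl {P})))))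
  ... | no  s≢P  = cong (E r) (punchInℕ-suc s≢P)
  same-minors : ∀ X → M F X ≡ M G X
  same-minors X = perℕ-cong n (λ a b _ _ → F≡G-off-R (punchInℕ R a) (punchInℕ X b) (punchInℕ-≢ R a))
  same-terms : ∀ t → t < n → F R (punchInℕ P t) * M F (punchInℕ P t) ≡ G R (punchInℕ P t) * M G (punchInℕ P t)
  same-terms t _ = cong₂ _*_ (cong (E R) (punchInℕ-suc (punchInℕ-≢ P t))) (same-minors (punchInℕ P t))
  shift : ∀ a b m s → a * m + s ≡ (b * m + s) + (a - b) * m
  shift = solve-∀

-- The matrix L̃

upperRow : ℕ → ℕ → Bool
upperRow r s = suc (r ℕ.+ r) ≤ᵇ s

lowerRow : ℕ → ℕ → Bool
lowerRow t s = not (suc (suc (t ℕ.+ t)) ≤ᵇ s)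

entry : ℕ → ℕ → ℕ → Bool
entry n r s = if r <ᵇ n then upperRow r s else lowerRow (r ∸ n) s

data RowView (n : ℕ) : ℕ → Set where
  upper : ∀ {r} → r < n → RowView n r
  lower : ∀ t → RowView n (n ℕ.+ t)

rowView : ∀ n r → RowView n r
rowView n r with r <? n
... | yes r<n = upper r<n
... | no  r≮n = subst (RowView n) (ℕP.m+[n∸m]≡n (ℕP.≮⇒≥ r≮n)) (lower (r ∸ n))

entry-upper : ∀ {n r} s → r < n → entry n r s ≡ upperRow r s
entry-upper s r<n rewrite <ᵇ-true r<n = refl

entry-lower : ∀ n t s → entry n (n ℕ.+ t) s ≡ lowerRow t s
entry-lower n t s rewrite <ᵇ-false {n ℕ.+ t} (ℕP.m≤m+n n t) | ℕP.m+n∸m≡n n t = refl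

ell-upper : ∀ n r s → r < n → s ≤ n ℕ.+ n → ell (suc n) (suc r) (suc s) ≡ b2z (upperRow r s)
ell-upper n r s r<n s≤ = cong b2z eq
  where
  eq : (  ((1 ≤ᵇ suc r) ∧ (suc r ≤ᵇ suc n ∸ 1) ∧ (2 ℕ.* suc r ≤ᵇ suc s) ∧ (suc s ≤ᵇ 2 ℕ.* suc n ∸ 1))
        ∨ ((suc n ≤ᵇ suc r) ∧ (suc r ≤ᵇ 2 ℕ.* suc n ∸ 2) ∧ (1 ≤ᵇ suc s)
           ∧ (suc s ≤ᵇ 2 ℕ.* (suc r ∸ suc n) ℕ.+ 2))
        ∨ (suc r ≡ᵇ 2 ℕ.* suc n ∸ 1)) ≡ upperRow r s
  eq rewrite +-suc-+0 r | +-suc-+0 n | <ᵇ-true r<n | <ᵇ-true (s≤s s≤) | <ᵇ-false r<n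
     | ≡ᵇ-false (ℕP.<⇒≢ (ℕP.<-≤-trans r<n (ℕP.m≤m+n n n)))
     | BoolP.∧-identityʳ (upperRow r s) = BoolP.∨-identityʳ (upperRow r s)

ell-lower : ∀ n t s → t < n → ell (suc n) (suc (n ℕ.+ t)) (suc s) ≡ b2z (lowerRow t s)
ell-lower n t s t<n = cong b2z (trans eq (<ᵇ≡not-≤ᵇ s (suc (suc (t ℕ.+ t)))))
  where
  r : ℕ
  r = n ℕ.+ t
  eq : (  ((1 ≤ᵇ suc r) ∧ (suc r ≤ᵇ suc n ∸ 1) ∧ (2 ℕ.* suc r ≤ᵇ suc s) ∧ (suc s ≤ᵇ 2 ℕ.* suc n ∸ 1))
        ∨ ((suc n ≤ᵇ suc r) ∧ (suc r ≤ᵇ 2 ℕ.* suc n ∸ 2) ∧ (1 ≤ᵇ suc s)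
           ∧ (suc s ≤ᵇ 2 ℕ.* (suc r ∸ suc n) ℕ.+ 2))
        ∨ (suc r ≡ᵇ 2 ℕ.* suc n ∸ 1)) ≡ (s <ᵇ suc (suc (t ℕ.+ t)))
  eq rewrite +-suc-+0 n | ℕP.m+n∸m≡n n t
     | <ᵇ-false {r} (ℕP.m≤m+n n t)
     | <ᵇ-true {n} {suc r} (s≤s (ℕP.m≤m+n n t))
     | <ᵇ-true (ℕP.+-monoʳ-< n t<n)
     | ≡ᵇ-false (λ e → ℕP.<-irrefl (ℕP.+-cancelˡ-≡ n t n e) t<n)
     | ℕP.+-identityʳ t | ℕP.+-comm (t ℕ.+ t) 2
     = BoolP.∨-identityʳ _

ell≡entry : ∀ n r s → r < n ℕ.+ n → s ≤ n ℕ.+ n → ell (suc n) (suc r) (suc s) ≡ b2z (entry n r s)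
ell≡entry n r s r< s≤ with rowView n r
... | upper r<n = trans (ell-upper n r s r<n s≤) (cong b2z (sym (entry-upper s r<n)))
... | lower t   = trans (ell-lower n t s (ℕP.+-cancelˡ-< n t n r<)) (cong b2z (sym (entry-lower n t s)))

Lt≡perℕ : ∀ n c → c ≤ n ℕ.+ n →
  Lt (suc n) (suc c) ≡ perℕ (n ℕ.+ n) (λ r s → b2z (entry n r (punchInℕ c s)))
Lt≡perℕ n c c≤ = unfold (2 ℕ.* suc n ∸ 1) (2 ℕ.* suc n ∸ 2) (cong (_∸ 1) (2*suc n)) (cong (_∸ 2) (2*suc n))
  where
  L : ∀ {N} → Fin N → Fin N → ℤ
  L i j = ell (suc n) (suc (toℕ i)) (if suc (toℕ j) <ᵇ suc c then suc (toℕ j) else suc (suc (toℕ j)))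
  skip-column : ∀ j → (if suc j <ᵇ suc c then suc j else suc (suc j)) ≡ suc (punchInℕ c j)
  skip-column j with j <ᵇ c
  ... | true  = refl
  ... | false = refl
  unfold : ∀ X Y → X ≡ suc (n ℕ.+ n) → Y ≡ n ℕ.+ n →
    (if suc c ≤ᵇ X then per Y L else + 0) ≡ perℕ (n ℕ.+ n) (λ r s → b2z (entry n r (punchInℕ c s)))
  unfold _ _ refl refl rewrite <ᵇ-true (s≤s c≤) =
    per-cong (n ℕ.+ n) (λ i j →
      trans (cong (ell (suc n) (suc (toℕ i))) (skip-column (toℕ j)))
            (ell≡entry n (toℕ i) (punchInℕ c (toℕ j)) (toℕ<n i)
                       (ℕP.≤-trans (punchInℕ-≤ c (toℕ j)) (toℕ<n j))))

Lt-beyond : ∀ n c → n ℕ.+ n < c → Lt (suc n) (suc c) ≡ + 0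
Lt-beyond n c n+n<c = vanish (2 ℕ.* suc n ∸ 1) (cong (_∸ 1) (2*suc n))
  where
  vanish : ∀ X → X ≡ suc (n ℕ.+ n) → ∀ {z} → (if suc c ≤ᵇ X then z else + 0) ≡ + 0
  vanish _ refl rewrite <ᵇ-false n+n<c = refl

Lt-suc≡perℕ : ∀ n c → c ≤ suc (suc (n ℕ.+ n)) →
  Lt (suc (suc n)) (suc c) ≡ perℕ (suc (suc (n ℕ.+ n))) (λ r s → b2z (entry (suc n) r (punchInℕ c s)))
Lt-suc≡perℕ n c c≤ =
  trans (Lt≡perℕ (suc n) c (subst (c ≤_) (sym size) c≤))
        (cong (λ N → perℕ N (λ r s → b2z (entry (suc n) r (punchInℕ c s)))) size)
  where
  size : suc n ℕ.+ suc n ≡ suc (suc (n ℕ.+ n))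
  size = cong suc (ℕP.+-suc n n)

perℕ-expand-into-Lt : ∀ n (D : ℕ → ℕ → ℤ) {q} (v : ℕ → ℤ) → q < suc (n ℕ.+ n) →
  (∀ x → x < suc (n ℕ.+ n) → D q x ≡ v x) →
  (∀ a y → a < n ℕ.+ n → y < suc (n ℕ.+ n) → D (punchInℕ q a) y ≡ b2z (entry n a y)) →
  perℕ (suc (n ℕ.+ n)) D ≡ Σ< (suc (n ℕ.+ n)) (λ x → v x * Lt (suc n) (suc x))
perℕ-expand-into-Lt n D v q< row-q other-rows =
  trans (perℕ-expand (n ℕ.+ n) D q<)
        (Σ<-cong (suc (n ℕ.+ n)) (λ X X< → cong₂ _*_ (row-q X X<)
          (trans (perℕ-cong (n ℕ.+ n) (λ a b a< b< →
                    other-rows a (punchInℕ X b) a< (s≤s (ℕP.≤-trans (punchInℕ-≤ X b) b<))))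
                 (sym (Lt≡perℕ n X (ℕP.≤-pred X<))))))

entry-columns-odd : ∀ n K r → r ≢ suc n ℕ.+ K →
  entry (suc n) r (suc (K ℕ.+ K)) ≡ entry (suc n) r (suc (suc (K ℕ.+ K)))
entry-columns-odd n K r r≢ with rowView (suc n) r
... | upper r<n = trans (entry-upper (suc (K ℕ.+ K)) r<n) (trans
        (≤ᵇ-suc (λ eq → double≢odd r K (ℕP.suc-injective eq)))
        (sym (entry-upper (suc (suc (K ℕ.+ K))) r<n)))
... | lower t = trans (entry-lower (suc n) t (suc (K ℕ.+ K))) (trans
        (cong not (≤ᵇ-suc (λ eq → r≢ (cong (suc n ℕ.+_)
          (double-injective (ℕP.suc-injective (ℕP.suc-injective eq)))))))
        (sym (entry-lower (suc n) t (suc (suc (K ℕ.+ K))))))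

entry-columns-even : ∀ n K r → r ≢ K →
  entry (suc n) r (K ℕ.+ K) ≡ entry (suc n) r (suc (K ℕ.+ K))
entry-columns-even n K r r≢K with rowView (suc n) r
... | upper r<n = trans (entry-upper (K ℕ.+ K) r<n) (trans
        (≤ᵇ-suc (λ eq → r≢K (double-injective (ℕP.suc-injective eq))))
        (sym (entry-upper (suc (K ℕ.+ K)) r<n)))
... | lower t = trans (entry-lower (suc n) t (K ℕ.+ K)) (trans
        (cong not (≤ᵇ-suc (λ eq → double≢odd K t (sym (ℕP.suc-injective eq)))))
        (sym (entry-lower (suc n) t (suc (K ℕ.+ K)))))

-- Deleting two adjacent columns

≤ᵇ-punchInPair-below : ∀ {θ P} y → θ ≤ P → (θ ≤ᵇ punchInPair P y) ≡ (θ ≤ᵇ y)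
≤ᵇ-punchInPair-below {θ} {P} y θ≤P with y <? P
... | yes y<P rewrite punchInPair-< y<P = refl
... | no  y≮P rewrite punchInPair-≥ (ℕP.≮⇒≥ y≮P)
                    | ≤ᵇ-true (ℕP.m≤n⇒m≤o+n 2 (ℕP.≤-trans θ≤P (ℕP.≮⇒≥ y≮P)))
                    | ≤ᵇ-true (ℕP.≤-trans θ≤P (ℕP.≮⇒≥ y≮P)) = refl

≤ᵇ-punchInPair-above : ∀ {θ P} y → P ≤ θ → (suc (suc θ) ≤ᵇ punchInPair P y) ≡ (θ ≤ᵇ y)
≤ᵇ-punchInPair-above {θ} {P} y P≤θ with y <? P | θ ≤? y
... | yes y<P | _ rewrite punchInPair-< y<P
                        | ≤ᵇ-false (ℕP.m≤n⇒m≤o+n 2 (ℕP.<-≤-trans y<P P≤θ))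
                        | ≤ᵇ-false (ℕP.<-≤-trans y<P P≤θ) = refl
... | no y≮P | yes θ≤y rewrite punchInPair-≥ (ℕP.≮⇒≥ y≮P) | ≤ᵇ-true (s≤s (s≤s θ≤y))
                            | ≤ᵇ-true θ≤y = refl
... | no y≮P | no  θ≰y rewrite punchInPair-≥ (ℕP.≮⇒≥ y≮P) | ≤ᵇ-false (s≤s (s≤s (ℕP.≰⇒> θ≰y)))
                            | ≤ᵇ-false (ℕP.≰⇒> θ≰y) = refl

≤ᵇ-punchInPair-near : ∀ {θ P} y → P ≤ θ → θ ≤ suc (suc P) → (θ ≤ᵇ punchInPair P y) ≡ (P ≤ᵇ y)
≤ᵇ-punchInPair-near {θ} {P} y P≤θ θ≤2+P with y <? P
... | yes y<P rewrite punchInPair-< y<P | ≤ᵇ-false (ℕP.<-≤-trans y<P P≤θ) | ≤ᵇ-false y<P = refl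
... | no  y≮P rewrite punchInPair-≥ (ℕP.≮⇒≥ y≮P)
                    | ≤ᵇ-true (ℕP.≤-trans θ≤2+P (s≤s (s≤s (ℕP.≮⇒≥ y≮P))))
                    | ≤ᵇ-true (ℕP.≮⇒≥ y≮P) = refl

module _ {K P : ℕ} (2K≤P : K ℕ.+ K ≤ P) (P≤2K+1 : P ≤ suc (K ℕ.+ K)) where

  upperRow-punchInPair : ∀ r y → upperRow (punchInℕ K r) (punchInPair P y) ≡ upperRow r y
  upperRow-punchInPair r y with r <? K
  ... | yes r<K rewrite punchInℕ-< r<K =
    ≤ᵇ-punchInPair-below y (ℕP.≤-trans (ℕP.≤-trans (ℕP.n≤1+n _) (double-< r<K)) 2K≤P)
  ... | no  r≮K rewrite punchInℕ-≥ (ℕP.≮⇒≥ r≮K) | ℕP.+-suc r r =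
    ≤ᵇ-punchInPair-above y (ℕP.≤-trans P≤2K+1 (s≤s (double-≤ (ℕP.≮⇒≥ r≮K))))

  lowerRow-punchInPair : ∀ t y → lowerRow (punchInℕ K t) (punchInPair P y) ≡ lowerRow t y
  lowerRow-punchInPair t y with t <? K
  ... | yes t<K rewrite punchInℕ-< t<K =
    cong not (≤ᵇ-punchInPair-below y (ℕP.≤-trans (double-< t<K) 2K≤P))
  ... | no  t≮K rewrite punchInℕ-≥ (ℕP.≮⇒≥ t≮K) | ℕP.+-suc t t =
    cong not (≤ᵇ-punchInPair-above y
      (ℕP.≤-trans P≤2K+1 (ℕP.m≤n⇒m≤1+n (s≤s (double-≤ (ℕP.≮⇒≥ t≮K))))))

  upperRow-deleted : ∀ y → upperRow K (punchInPair P y) ≡ (P ≤ᵇ y)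
  upperRow-deleted y = ≤ᵇ-punchInPair-near y P≤2K+1 (ℕP.m≤n⇒m≤1+n (s≤s 2K≤P))

  lowerRow-deleted : ∀ y → lowerRow K (punchInPair P y) ≡ not (P ≤ᵇ y)
  lowerRow-deleted y = cong not (≤ᵇ-punchInPair-near y (ℕP.m≤n⇒m≤1+n P≤2K+1) (s≤s (s≤s 2K≤P)))

  entry-punchInPair-upper : ∀ {n a} y → a < n →
    entry (suc n) (punchInℕ K a) (punchInPair P y) ≡ entry n a y
  entry-punchInPair-upper {a = a} y a<n =
    trans (entry-upper (punchInPair P y) (s≤s (ℕP.≤-trans (punchInℕ-≤ K a) a<n)))
          (trans (upperRow-punchInPair a y) (sym (entry-upper y a<n)))

  entry-punchInPair-lower : ∀ n t y →
    entry (suc n) (suc n ℕ.+ punchInℕ K t) (punchInPair P y) ≡ entry n (n ℕ.+ t) y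
  entry-punchInPair-lower n t y =
    trans (entry-lower (suc n) (punchInℕ K t) (punchInPair P y))
          (trans (lowerRow-punchInPair t y) (sym (entry-lower n t y)))

pairMinor : ℕ → ℕ → ℕ → ℕ → ℕ → ℤ
pairMinor n R P a b = b2z (entry n (punchInℕ R a) (punchInPair P b))

module _ {n K P : ℕ} (K≤n : K ≤ n) (2K≤P : K ℕ.+ K ≤ P) (P≤2K+1 : P ≤ suc (K ℕ.+ K)) where

  private
    K<2n+1 : K < suc (n ℕ.+ n)
    K<2n+1 = s≤s (ℕP.≤-trans K≤n (ℕP.m≤m+n n n))

    punchInℕ-K-upper : ∀ {a} → a < n → punchInℕ K a ≤ n
    punchInℕ-K-upper {a} a<n = ℕP.≤-trans (punchInℕ-≤ K a) a<n

  perℕ-pairMinor-lower : perℕ (suc (n ℕ.+ n)) (pairMinor (suc n) (suc n ℕ.+ K) P)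
                         ≡ Σ< (suc (n ℕ.+ n)) (λ x → b2z (P ≤ᵇ x) * Lt (suc n) (suc x))
  perℕ-pairMinor-lower =
    perℕ-expand-into-Lt n (pairMinor (suc n) (suc n ℕ.+ K) P) (λ x → b2z (P ≤ᵇ x)) K<2n+1 row-K
      (λ a y a< _ → cong b2z (row a y a<))
    where
    row-K : ∀ x → x < suc (n ℕ.+ n) → pairMinor (suc n) (suc n ℕ.+ K) P K x ≡ b2z (P ≤ᵇ x)
    row-K x _ = cong b2z (begin
      entry (suc n) (punchInℕ (suc n ℕ.+ K) K) (punchInPair P x)
        ≡⟨ cong (λ r → entry (suc n) r (punchInPair P x)) (punchInℕ-< (s≤s (ℕP.m≤n+m K n))) ⟩
      entry (suc n) K (punchInPair P x)
        ≡⟨ entry-upper (punchInPair P x) (s≤s K≤n) ⟩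
      upperRow K (punchInPair P x)
        ≡⟨ upperRow-deleted {K} 2K≤P P≤2K+1 x ⟩
      (P ≤ᵇ x) ∎)
      where open ≡-Reasoning
    row : ∀ a y → a < n ℕ.+ n →
      entry (suc n) (punchInℕ (suc n ℕ.+ K) (punchInℕ K a)) (punchInPair P y) ≡ entry n a y
    row a y a< with rowView n a
    ... | upper a<n =
      trans (cong (λ r → entry (suc n) r (punchInPair P y))
                  (punchInℕ-< (s≤s (ℕP.≤-trans (punchInℕ-K-upper a<n) (ℕP.m≤m+n n K)))))
            (entry-punchInPair-upper {K} 2K≤P P≤2K+1 y a<n)
    ... | lower t =
      trans (cong (λ r → entry (suc n) r (punchInPair P y))
                  (trans (cong (punchInℕ (suc n ℕ.+ K)) (punchInℕ-≥ (ℕP.≤-trans K≤n (ℕP.m≤m+n n t))))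
                         (punchInℕ-+ (suc n) K t)))
            (entry-punchInPair-lower {K} 2K≤P P≤2K+1 n t y)

  perℕ-pairMinor-upper : perℕ (suc (n ℕ.+ n)) (pairMinor (suc n) K P)
                         ≡ Σ< (suc (n ℕ.+ n)) (λ x → b2z (not (P ≤ᵇ x)) * Lt (suc n) (suc x))
  perℕ-pairMinor-upper =
    perℕ-expand-into-Lt n (pairMinor (suc n) K P) (λ x → b2z (not (P ≤ᵇ x))) (s≤s (ℕP.+-monoʳ-≤ n K≤n)) row-n+K
      (λ a y a< _ → cong b2z (row a y a<))
    where
    row-n+K : ∀ x → x < suc (n ℕ.+ n) → pairMinor (suc n) K P (n ℕ.+ K) x ≡ b2z (not (P ≤ᵇ x))
    row-n+K x _ = cong b2z (begin
      entry (suc n) (punchInℕ K (n ℕ.+ K)) (punchInPair P x)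
        ≡⟨ cong (λ r → entry (suc n) r (punchInPair P x)) (punchInℕ-≥ (ℕP.m≤n+m K n)) ⟩
      entry (suc n) (suc n ℕ.+ K) (punchInPair P x)
        ≡⟨ entry-lower (suc n) K (punchInPair P x) ⟩
      lowerRow K (punchInPair P x)
        ≡⟨ lowerRow-deleted {K} 2K≤P P≤2K+1 x ⟩
      not (P ≤ᵇ x) ∎)
      where open ≡-Reasoning
    row : ∀ a y → a < n ℕ.+ n →
      entry (suc n) (punchInℕ K (punchInℕ (n ℕ.+ K) a)) (punchInPair P y) ≡ entry n a y
    row a y a< with rowView n a
    ... | upper a<n =
      trans (cong (λ r → entry (suc n) (punchInℕ K r) (punchInPair P y))
                  (punchInℕ-< (ℕP.<-≤-trans a<n (ℕP.m≤m+n n K))))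
            (entry-punchInPair-upper {K} 2K≤P P≤2K+1 y a<n)
    ... | lower t =
      trans (cong (λ r → entry (suc n) r (punchInPair P y))
                  (trans (cong (punchInℕ K) (punchInℕ-+ n K t))
                         (punchInℕ-≥ (ℕP.≤-trans K≤n (ℕP.m≤m+n n (punchInℕ K t))))))
            (entry-punchInPair-lower {K} 2K≤P P≤2K+1 n t y)

-- The recurrences

module _ (n : ℕ) where

  private
    m N : ℕ
    m = suc (suc n)
    N = suc (n ℕ.+ n)
    E : ℕ → ℕ → ℤ
    E r s = b2z (entry (suc n) r s)

  Lt-first : Lt m 1 ≡ Lt m 0 + sumFromTo 0 N (Lt (suc n))
  Lt-first = begin
    Lt m 1
      ≡⟨ Lt-suc≡perℕ n 0 z≤n ⟩
    perℕ (suc N) (λ r s → E r (punchInℕ 0 s))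
      ≡⟨ perℕ-single N (λ r s → E r (punchInℕ 0 s)) {suc n ℕ.+ 0} {0}
           (s≤s (s≤s (ℕP.+-monoʳ-≤ n z≤n))) (s≤s z≤n)
           (λ b _ → cong b2z (entry-lower (suc n) 0 (suc (suc b)))) ⟩
    E (suc n ℕ.+ 0) 1 * perℕ N (pairMinor (suc n) (suc n ℕ.+ 0) 0)
      ≡⟨ trans (cong (_* perℕ N (pairMinor (suc n) (suc n ℕ.+ 0) 0)) (cong b2z (entry-lower (suc n) 0 1)))
               (ℤP.*-identityˡ _) ⟩
    perℕ N (pairMinor (suc n) (suc n ℕ.+ 0) 0)
      ≡⟨ perℕ-pairMinor-lower {n} z≤n z≤n z≤n ⟩
    Σ< N (λ x → + 1 * Lt (suc n) (suc x))
      ≡⟨ Σ<-cong N (λ x _ → ℤP.*-identityˡ (Lt (suc n) (suc x))) ⟩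
    Σ< N (λ x → Lt (suc n) (suc x))
      ≡⟨ sym (trans (ℤP.+-identityˡ _) (trans (sumFromTo-Σ< 0 N (Lt (suc n))) (ℤP.+-identityˡ _))) ⟩
    Lt m 0 + sumFromTo 0 N (Lt (suc n)) ∎
    where open ≡-Reasoning

  Lt-odd : ∀ K → K ≤ n →
    Lt m (suc (suc (suc (K ℕ.+ K)))) ≡ Lt m (suc (suc (K ℕ.+ K))) + sumFromTo (suc (suc (K ℕ.+ K))) N (Lt (suc n))
  Lt-odd K K≤n = begin
    Lt m (suc (suc P))
      ≡⟨ Lt-suc≡perℕ n (suc P) (s≤s P≤N) ⟩
    perℕ (suc N) (λ r s → E r (punchInℕ (suc P) s))
      ≡⟨ perℕ-adjacent-columns N E {R} {P} (s≤s (s≤s (ℕP.+-monoʳ-≤ n K≤n))) (s≤s P≤N)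
           (λ r r≢R → cong b2z (entry-columns-odd n K r r≢R)) ⟩
    perℕ (suc N) (λ r s → E r (punchInℕ P s)) + (E R P - E R (suc P)) * perℕ N (pairMinor (suc n) R P)
      ≡⟨ cong₂ (λ a c → a + c * perℕ N (pairMinor (suc n) R P))
               (sym (Lt-suc≡perℕ n P (ℕP.m≤n⇒m≤1+n P≤N))) jump ⟩
    Lt m (suc P) + + 1 * perℕ N (pairMinor (suc n) R P)
      ≡⟨ cong (_+_ (Lt m (suc P)))
              (trans (ℤP.*-identityˡ _) (perℕ-pairMinor-lower {n} K≤n (ℕP.n≤1+n _) ℕP.≤-refl)) ⟩
    Lt m (suc P) + Σ< N (λ x → b2z (P ≤ᵇ x) * Lt (suc n) (suc x))
      ≡⟨ cong (_+_ (Lt m (suc P))) (trans (Σ<-from (λ x → Lt (suc n) (suc x)) P≤N)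
                                          (sym (sumFromTo-Σ< (suc P) N (Lt (suc n))))) ⟩
    Lt m (suc P) + sumFromTo (suc P) N (Lt (suc n)) ∎
    where
    open ≡-Reasoning
    P R : ℕ
    P = suc (K ℕ.+ K)
    R = suc n ℕ.+ K
    P≤N : P ≤ N
    P≤N = s≤s (double-≤ K≤n)
    jump : E R P - E R (suc P) ≡ + 1
    jump = cong₂ (λ a b → b2z a - b2z b)
             (trans (entry-lower (suc n) K P) (cong not (≤ᵇ-false (ℕP.n<1+n P))))
             (trans (entry-lower (suc n) K (suc P)) (cong not (≤ᵇ-true (ℕP.≤-refl {suc P}))))

  Lt-even : ∀ K → K ≤ n →
    Lt m (suc (suc (K ℕ.+ K))) ≡ Lt m (suc (K ℕ.+ K)) - sumFromTo 1 (K ℕ.+ K) (Lt (suc n))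
  Lt-even K K≤n = begin
    Lt m (suc (suc P))
      ≡⟨ Lt-suc≡perℕ n (suc P) (s≤s (ℕP.m≤n⇒m≤1+n P≤2n)) ⟩
    perℕ (suc N) (λ r s → E r (punchInℕ (suc P) s))
      ≡⟨ perℕ-adjacent-columns N E {K} {P}
           (s≤s (ℕP.≤-trans K≤n (ℕP.≤-trans (ℕP.m≤m+n n n) (ℕP.n≤1+n _))))
           (s≤s (ℕP.m≤n⇒m≤1+n P≤2n)) (λ r r≢K → cong b2z (entry-columns-even n K r r≢K)) ⟩
    perℕ (suc N) (λ r s → E r (punchInℕ P s)) + (E K P - E K (suc P)) * perℕ N (pairMinor (suc n) K P)
      ≡⟨ cong₂ (λ a c → a + c * perℕ N (pairMinor (suc n) K P))
               (sym (Lt-suc≡perℕ n P (ℕP.m≤n⇒m≤1+n (ℕP.m≤n⇒m≤1+n P≤2n)))) jump ⟩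
    Lt m (suc P) + ℤ.-[1+ 0 ] * perℕ N (pairMinor (suc n) K P)
      ≡⟨ cong (_+_ (Lt m (suc P))) (ℤP.-1*i≡-i _) ⟩
    Lt m (suc P) - perℕ N (pairMinor (suc n) K P)
      ≡⟨ cong (Lt m (suc P) -_) (trans (perℕ-pairMinor-upper {n} K≤n ℕP.≤-refl (ℕP.n≤1+n _))
                                       (Σ<-below (λ x → Lt (suc n) (suc x)) (ℕP.m≤n⇒m≤1+n P≤2n))) ⟩
    Lt m (suc P) - Σ< P (λ x → Lt (suc n) (suc x))
      ≡⟨ cong (Lt m (suc P) -_) (sym (sumFromTo-Σ< 1 P (Lt (suc n)))) ⟩
    Lt m (suc P) - sumFromTo 1 P (Lt (suc n)) ∎
    where
    open ≡-Reasoning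
    P : ℕ
    P = K ℕ.+ K
    P≤2n : P ≤ n ℕ.+ n
    P≤2n = double-≤ K≤n
    jump : E K P - E K (suc P) ≡ ℤ.-[1+ 0 ]
    jump = cong₂ (λ a b → b2z a - b2z b)
             (trans (entry-upper P (s≤s K≤n)) (≤ᵇ-false (ℕP.n<1+n P)))
             (trans (entry-upper (suc P) (s≤s K≤n)) (≤ᵇ-true (ℕP.≤-refl {suc P})))

  Lt-last : Lt m (suc (suc (suc N))) ≡ Lt m (suc (suc N)) - sumFromTo 1 (suc N) (Lt (suc n))
  Lt-last = begin
    Lt m (suc (suc (suc N)))
      ≡⟨ Lt-beyond (suc n) (suc (suc N)) (s≤s (s≤s (ℕP.≤-reflexive (ℕP.+-suc n n)))) ⟩
    + 0
      ≡⟨ cancel (Lt m (suc (suc N))) ⟩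
    Lt m (suc (suc N)) - (Lt m (suc (suc N)) + + 0)
      ≡⟨ cong (λ z → Lt m (suc (suc N)) - z) (cong₂ _+_ last-column (sym last-term)) ⟩
    Lt m (suc (suc N)) - (Σ< N (λ x → Lt (suc n) (suc x)) + Lt (suc n) (suc N))
      ≡⟨ cong (λ z → Lt m (suc (suc N)) - z)
              (sym (trans (sumFromTo-Σ< 1 (suc N) (Lt (suc n))) (Σ<-last N (λ x → Lt (suc n) (suc x))))) ⟩
    Lt m (suc (suc N)) - sumFromTo 1 (suc N) (Lt (suc n)) ∎
    where
    open ≡-Reasoning
    cancel : ∀ x → + 0 ≡ x - (x + + 0)
    cancel = solve-∀
    last-term : Lt (suc n) (suc N) ≡ + 0
    last-term = Lt-beyond n N ℕP.≤-refl
    F : ℕ → ℕ → ℤ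
    F r s = E r (punchInℕ (suc N) s)
    last-column : Lt m (suc (suc N)) ≡ Σ< N (λ x → Lt (suc n) (suc x))
    last-column = begin
      Lt m (suc (suc N))
        ≡⟨ Lt-suc≡perℕ n (suc N) ℕP.≤-refl ⟩
      perℕ (suc N) F
        ≡⟨ perℕ-single N F {n} {N} (s≤s (ℕP.≤-trans (ℕP.m≤m+n n n) (ℕP.n≤1+n _))) ℕP.≤-refl
             (λ b b<N → cong b2z (trans (cong (entry (suc n) n) (punchInPair-< b<N))
                                 (trans (entry-upper {r = n} b ℕP.≤-refl) (≤ᵇ-false b<N)))) ⟩
      F n N * perℕ N (pairMinor (suc n) n N)
        ≡⟨ cong₂ _*_ (cong b2z (trans (cong (entry (suc n) n) (punchInℕ-< (ℕP.n<1+n N)))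
                                      (trans (entry-upper {r = n} N ℕP.≤-refl) (≤ᵇ-true (ℕP.≤-refl {N})))))
                     (perℕ-pairMinor-upper {n} ℕP.≤-refl (ℕP.n≤1+n _) ℕP.≤-refl) ⟩
      + 1 * Σ< N (λ x → b2z (not (N ≤ᵇ x)) * Lt (suc n) (suc x))
        ≡⟨ trans (ℤP.*-identityˡ _) (Σ<-below {N} {N} (λ x → Lt (suc n) (suc x)) ℕP.≤-refl) ⟩
      Σ< N (λ x → Lt (suc n) (suc x)) ∎

lemma2p2 : (m k : ℕ) → 2 ≤ m → 1 ≤ k → k ≤ m →
    (Lt m (2 ℕ.* k ∸ 1) ≡ Lt m (2 ℕ.* k ∸ 2) + sumFromTo (2 ℕ.* k ∸ 2) (2 ℕ.* m ∸ 3) (Lt (m ∸ 1)))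
    × (Lt m (2 ℕ.* k) ≡ Lt m (2 ℕ.* k ∸ 1) - sumFromTo 1 (2 ℕ.* k ∸ 2) (Lt (m ∸ 1)))
lemma2p2 zero          _       ()          _   _
lemma2p2 (suc zero)    _       (s≤s ())    _   _
lemma2p2 (suc (suc n)) zero    _           ()  _
lemma2p2 (suc (suc n)) (suc k) _           _   (s≤s k≤1+n) =
  unfold-doubles (2*suc k) (trans (2*suc (suc n)) (cong (suc ∘ suc ∘ suc) (ℕP.+-suc n n)))
                 (odd-column k k≤1+n) even-column
  where
  m N : ℕ
  m = suc (suc n)
  N = suc (n ℕ.+ n)
  unfold-doubles : ∀ {a b} → a ≡ suc (suc (k ℕ.+ k)) → b ≡ suc (suc (suc N)) →
    Lt m (suc (k ℕ.+ k)) ≡ Lt m (k ℕ.+ k) + sumFromTo (k ℕ.+ k) N (Lt (suc n)) →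
    Lt m (suc (suc (k ℕ.+ k))) ≡ Lt m (suc (k ℕ.+ k)) - sumFromTo 1 (k ℕ.+ k) (Lt (suc n)) →
    (Lt m (a ∸ 1) ≡ Lt m (a ∸ 2) + sumFromTo (a ∸ 2) (b ∸ 3) (Lt (suc n)))
    × (Lt m a ≡ Lt m (a ∸ 1) - sumFromTo 1 (a ∸ 2) (Lt (suc n)))
  unfold-doubles refl refl odd even = odd , even
  odd-column : ∀ k → k ≤ suc n → Lt m (suc (k ℕ.+ k)) ≡ Lt m (k ℕ.+ k) + sumFromTo (k ℕ.+ k) N (Lt (suc n))
  odd-column zero    _         = Lt-first n
  odd-column (suc K) (s≤s K≤n) rewrite ℕP.+-suc K K = Lt-odd n K K≤n
  even-column : Lt m (suc (suc (k ℕ.+ k))) ≡ Lt m (suc (k ℕ.+ k)) - sumFromTo 1 (k ℕ.+ k) (Lt (suc n))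
  even-column with ℕP.m≤n⇒m<n∨m≡n k≤1+n
  ... | inj₁ (s≤s k≤n) = Lt-even n k k≤n
  ... | inj₂ refl rewrite ℕP.+-suc n n = Lt-last n
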